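{- Let $k>2$ be a prime such that $2^k-1$ is prime. Let $n = 2^{\alpha-1}p^{\beta-1}$, where $\alpha,\beta>1$ are integers and $p$ is an odd prime with $p<3\cdot 2^{\alpha-1}-1$ and $p\equiv 3\pmod 4$. Suppose $n$ divides $\sigma_k(n)$. Write $\beta = 2^v\beta_1$, where $v\ge 1$ and $\beta_1$ is odd. Then $$p^{2^v-2k-1}\ <\ \frac{2^{k(v-1)}}{2^k-1}.$$
   Context: For a positive integer $n$ and integer $k\ge 1$, $\sigma_k(n)=\sum_{d\mid n} d^k$, the sum over positive divisors $d$ of $n$. -}

module Defs where

open import Data.Nat using (ℕ; zero; suc; _+_; _*_; _^_; NonZero)
open import Data.Nat.Properties using (m^n≢0)
open import Data.Nat.Divisibility using (_∣?_)
open import Data.List using (List; filter; map; upTo)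
open import Data.Nat.ListAction using (sum)
open import Data.Integer using (ℤ; +_; -[1+_])
open import Data.Rational using (ℚ; _/_)

divisors : ℕ → List ℕ
divisors n = filter (_∣? n) (map suc (upTo n))

σ : ℕ → ℕ → ℕ
σ k n = sum (map (λ d → d ^ k) (divisors n))

zpow : (p : ℕ) → .{{_ : NonZero p}} → ℤ → ℚ
zpow p (+ m) = + (p ^ m) / 1
zpow p -[1+ m ] = _/_ (+ 1) (p ^ suc m) {{m^n≢0 p (suc m)}}

module Submission where

-- Write n = 2^A · p^B with A = α - 1, B = β - 1 and M = 2^k - 1.
--
-- 1. Since 2 and p are distinct primes, σ_k(n) = S₂ · Sₚ with the geometric
--    sums S₂ = 1 + 2^k + … + 2^(kA) and Sₚ = 1 + p^k + … + p^(kB).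
--    S₂ is odd and Sₚ is prime to p, so n ∣ σ_k(n) splits into
--    2^A ∣ Sₚ and p^B ∣ S₂.
-- 2. Sₚ has β = 2^v·β₁ terms.  Halving the length v times shows
--    Sₚ = (1 + p^k) · 2^(v-1) · odd, and 1 + p^k = (1 + p) · odd since k is
--    odd.  Hence 2^A ≤ 2^(v-1)(1 + p), i.e. 2^α ≤ 2^(v-1) · 2(1 + p) ≤ 2^(v-1) p².
-- 3. From p^B ≤ S₂ and M · S₂ + 1 = 2^(kα) we get p^B · M < (2^α)^k.
-- 4. Since 2^v ≤ β, chaining 1–3 gives p^(2^v) · M < p^(2k+1) · 2^(k(v-1)),
--    which is the claim after dividing by p^(2k+1) · M in ℚ.

open import Defs
open import Data.Nat using (ℕ; _+_; _*_; _^_; _∸_; _<_; _≤_; _%_)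
open import Data.Nat.Divisibility using (_∣_)
open import Data.Nat.Primality using (Prime; prime⇒nonZero)
open import Data.Integer using (+_; _-_)
open import Data.Rational using (_/_) renaming (_<_ to _<ℚ_)
open import Relation.Binary.PropositionalEquality using (_≡_)

open import Data.Nat as ℕ using (zero; suc; NonZero; >-nonZero; z≤n; s≤s; ≢-nonZero⁻¹; nonTrivial⇒n>1)
open import Data.Nat.Properties
open import Data.Nat.Divisibility
  using (divides; ∣-refl; ∣-trans; ∣1⇒≡1; 0∣⇒≡0; ∣⇒≤; ∣m+n∣m⇒∣n; ∣m⇒∣m*n;
         m∣m*n; n∣m*n; m*n∣⇒m∣; *-monoʳ-∣; *-pres-∣; *-cancelˡ-∣; 1∣_; _∣?_)
open import Data.Nat.DivMod using (m≡m%n+[m/n]*n)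
open import Data.Nat.Coprimality using (Coprime; coprime-divisor)
open import Data.Nat.Primality using (prime[2]; prime⇒nonTrivial; prime⇒irreducible; euclidsLemma)
open import Data.Nat.Tactic.RingSolver using (solve-∀)
open import Data.Nat.ListAction using (sum)
open import Data.Nat.ListAction.Properties using (sum-++; sum-↭)
open import Data.List using (List; []; _∷_; map; upTo; cartesianProductWith; _++_)
open import Data.List.Properties using (map-++; upTo-∷ʳ)
open import Data.List.Membership.Propositional using (_∈_)
open import Data.List.Membership.Propositional.Properties
  using (∈-filter⁺; ∈-filter⁻; ∈-map⁺; ∈-upTo⁺; ∈-upTo⁻;
         ∈-cartesianProductWith⁺; ∈-cartesianProductWith⁻)
open import Data.List.Relation.Unary.Unique.Propositional using (Unique)
import Data.List.Relation.Unary.Unique.Propositional.Properties as Unique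
open import Data.List.Membership.Propositional.Properties.WithK using (unique∧set⇒bag)
open import Data.List.Relation.Binary.BagAndSetEquality using (∼bag⇒↭)
open import Data.List.Relation.Binary.Permutation.Propositional using (_↭_)
import Data.List.Relation.Binary.Permutation.Propositional.Properties as Perm
open import Data.Integer as ℤ using (_⊖_)
import Data.Integer.Properties as ℤ
import Data.Rational.Properties as ℚ using (toℚᵘ-cancel-<; toℚᵘ-fromℚᵘ)
open import Data.Rational.Unnormalised as ℚᵘ using (mkℚᵘ)
import Data.Rational.Unnormalised.Properties as ℚᵘ
open import Data.Product using (∃; ∃₂; _×_; _,_; proj₁; proj₂)
open import Data.Sum using (_⊎_; inj₁; inj₂)
open import Data.Empty using (⊥-elim)
open import Function.Bundles using (mk⇔)
open import Relation.Nullary using (¬_; yes; no)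
open import Relation.Binary.Definitions using (tri<; tri≈; tri>)
open import Relation.Binary.PropositionalEquality
  using (refl; sym; trans; cong; cong₂; subst; subst₂; module ≡-Reasoning)

Odd : ℕ → Set
Odd n = ∃ λ s → n ≡ 1 + 2 * s

even-or-odd : ∀ n → 2 ∣ n ⊎ Odd n
even-or-odd zero = inj₁ (divides 0 refl)
even-or-odd (suc n) with even-or-odd n
... | inj₁ (divides h refl) = inj₂ (h , cong suc (*-comm h 2))
... | inj₂ (s , refl) = inj₁ (divides (suc s) (double-suc s))
  where
  double-suc : ∀ s → 2 + 2 * s ≡ (1 + s) * 2
  double-suc = solve-∀

%2≡1⇒odd : ∀ n → n % 2 ≡ 1 → Odd n
%2≡1⇒odd n h = n ℕ./ 2 , trans (m≡m%n+[m/n]*n n 2) (cong₂ _+_ h (*-comm (n ℕ./ 2) 2))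

∤1+multiple : ∀ {q c} x → 1 < q → q ∣ c → ¬ q ∣ 1 + c * x
∤1+multiple {q} {c} x 1<q q∣c q∣1+cx = <-irrefl (sym (∣1⇒≡1 q∣1)) 1<q
  where
  q∣1 : q ∣ 1
  q∣1 = ∣m+n∣m⇒∣n (subst (q ∣_) (+-comm 1 (c * x)) q∣1+cx) (∣m⇒∣m*n x q∣c)

odd⇒¬2∣ : ∀ {n} → Odd n → ¬ 2 ∣ n
odd⇒¬2∣ (s , refl) = ∤1+multiple s (s≤s (s≤s z≤n)) ∣-refl

¬2∣⇒odd : ∀ n → ¬ 2 ∣ n → Odd n
¬2∣⇒odd n 2∤n with even-or-odd n
... | inj₁ 2∣n = ⊥-elim (2∤n 2∣n)
... | inj₂ odd = odd

odd⇒nonZero : ∀ {n} → Odd n → NonZero n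
odd⇒nonZero (s , refl) = >-nonZero (s≤s z≤n)

odd-* : ∀ {a b} → Odd a → Odd b → Odd (a * b)
odd-* (s , refl) (t , refl) = s + t + 2 * s * t , expand s t
  where
  expand : ∀ s t → (1 + 2 * s) * (1 + 2 * t) ≡ 1 + 2 * (s + t + 2 * s * t)
  expand = solve-∀

odd-^ : ∀ {a} → Odd a → ∀ n → Odd (a ^ n)
odd-^ odd zero = 0 , refl
odd-^ odd (suc n) = odd-* odd (odd-^ odd n)

odd-square : ∀ {x} → Odd x → ∃ λ t → x * x ≡ 1 + 4 * t
odd-square (s , refl) = s + s * s , expand s
  where
  expand : ∀ s → (1 + 2 * s) * (1 + 2 * s) ≡ 1 + 4 * (s + s * s)
  expand = solve-∀

odd-prime : ∀ {k} → Prime k → 2 < k → Odd k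
odd-prime {k} pk 2<k = ¬2∣⇒odd k 2∤k
  where
  2∤k : ¬ 2 ∣ k
  2∤k 2∣k with prime⇒irreducible pk 2∣k
  ... | inj₁ ()
  ... | inj₂ refl = <-irrefl refl 2<k

double-succ≤square : ∀ {p} → 1 < p → Odd p → 2 * (1 + p) ≤ p * p
double-succ≤square 1<p (zero , refl) = ⊥-elim (<-irrefl refl 1<p)
double-succ≤square 1<p (suc u , refl) = subst (2 * (1 + p) ≤_) (expand u) (m≤m+n _ _)
  where
  p : ℕ
  p = 1 + 2 * suc u
  expand : ∀ u → 2 * (1 + (1 + 2 * (1 + u))) + (1 + 8 * u + 4 * (u * u))
               ≡ (1 + 2 * (1 + u)) * (1 + 2 * (1 + u))
  expand = solve-∀

geom : ℕ → ℕ → ℕ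
geom x zero = 0
geom x (suc m) = 1 + x * geom x m

geom-snoc : ∀ x m → geom x (suc m) ≡ geom x m + x ^ m
geom-snoc x zero = trans (cong suc (*-zeroʳ x)) (sym (*-identityʳ 1))
geom-snoc x (suc m) = trans (cong (λ g → 1 + x * g) (geom-snoc x m)) (distrib x (geom x m) (x ^ m))
  where
  distrib : ∀ x g y → 1 + x * (g + y) ≡ 1 + x * g + x * y
  distrib = solve-∀

sum-powers≡geom : ∀ x m → sum (map (x ^_) (upTo m)) ≡ geom x m
sum-powers≡geom x zero = refl
sum-powers≡geom x (suc m) = begin
  sum (map (x ^_) (upTo (suc m)))            ≡⟨ cong (λ l → sum (map (x ^_) l)) (sym (upTo-∷ʳ m)) ⟩
  sum (map (x ^_) (upTo m ++ m ∷ []))        ≡⟨ cong sum (map-++ (x ^_) (upTo m) (m ∷ [])) ⟩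
  sum (map (x ^_) (upTo m) ++ x ^ m ∷ [])    ≡⟨ sum-++ (map (x ^_) (upTo m)) (x ^ m ∷ []) ⟩
  sum (map (x ^_) (upTo m)) + (x ^ m + 0)    ≡⟨ cong₂ _+_ (sum-powers≡geom x m) (+-identityʳ (x ^ m)) ⟩
  geom x m + x ^ m                           ≡⟨ sym (geom-snoc x m) ⟩
  geom x (suc m)                             ∎
  where open ≡-Reasoning

geom-closed : ∀ {x} c m → x ≡ suc c → c * geom x m + 1 ≡ x ^ m
geom-closed c zero refl = cong (_+ 1) (*-zeroʳ c)
geom-closed {x} c (suc m) refl = begin
  c * (1 + x * geom x m) + 1 ≡⟨ regroup c (geom x m) ⟩
  x * (c * geom x m + 1)     ≡⟨ cong (x *_) (geom-closed c m refl) ⟩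
  x * x ^ m                  ∎
  where
  open ≡-Reasoning
  regroup : ∀ c g → c * (1 + (1 + c) * g) + 1 ≡ (1 + c) * (c * g + 1)
  regroup = solve-∀

-- Pairing consecutive terms: a sum of even length 2m factors as (1 + x) · geom (x²) m.
geom-double : ∀ x m → geom x (2 * m) ≡ (1 + x) * geom (x * x) m
geom-double x zero = sym (*-zeroʳ (1 + x))
geom-double x (suc m) = begin
  geom x (2 * suc m)                          ≡⟨ cong (geom x) (*-suc 2 m) ⟩
  1 + x * (1 + x * geom x (2 * m))            ≡⟨ cong (λ g → 1 + x * (1 + x * g)) (geom-double x m) ⟩
  1 + x * (1 + x * ((1 + x) * geom (x * x) m)) ≡⟨ regroup x (geom (x * x) m) ⟩
  (1 + x) * (1 + (x * x) * geom (x * x) m)    ∎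
  where
  open ≡-Reasoning
  regroup : ∀ x g → 1 + x * (1 + x * ((1 + x) * g)) ≡ (1 + x) * (1 + (x * x) * g)
  regroup = solve-∀

-- An odd number of odd terms has odd sum.
geom-odd : ∀ {y m} → Odd y → Odd m → Odd (geom y m)
geom-odd {y} (s , refl) (j , refl) =
  (1 + 2 * s) * (1 + s) * g , trans (cong (λ h → 1 + y * h) (geom-double y j)) (regroup s g)
  where
  g : ℕ
  g = geom (y * y) j
  regroup : ∀ s g → 1 + (1 + 2 * s) * ((1 + (1 + 2 * s)) * g) ≡ 1 + 2 * ((1 + 2 * s) * (1 + s) * g)
  regroup = solve-∀

square-1mod4 : ∀ t → (1 + 4 * t) * (1 + 4 * t) ≡ 1 + 4 * (2 * t + 4 * t * t)
square-1mod4 = solve-∀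

-- For y ≡ 1 (mod 4) and odd m, the sum of 2^w · m powers of y is exactly
-- divisible by 2^w: each halving of the length contributes one factor 1 + y ≡ 2 (mod 4).
geom-2-adic : ∀ w {y t m} → y ≡ 1 + 4 * t → Odd m →
              ∃ λ O → Odd O × geom y (2 ^ w * m) ≡ 2 ^ w * O
geom-2-adic zero {y} {t} {m} y≡1+4t odd-m =
  geom y m , geom-odd (2 * t , trans y≡1+4t (cong suc (*-assoc 2 2 t))) odd-m ,
  trans (cong (geom y) (*-identityˡ m)) (sym (*-identityˡ (geom y m)))
geom-2-adic (suc w) {y} {t} {m} y≡1+4t odd-m = (1 + 2 * t) * O , odd-* (t , refl) odd-O , (begin
  geom y (2 ^ suc w * m)             ≡⟨ cong (geom y) (*-assoc 2 (2 ^ w) m) ⟩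
  geom y (2 * (2 ^ w * m))           ≡⟨ geom-double y (2 ^ w * m) ⟩
  (1 + y) * geom (y * y) (2 ^ w * m) ≡⟨ cong ((1 + y) *_) eq ⟩
  (1 + y) * (2 ^ w * O)              ≡⟨ cong (λ z → (1 + z) * (2 ^ w * O)) y≡1+4t ⟩
  (2 + 4 * t) * (2 ^ w * O)          ≡⟨ regroup t (2 ^ w) O ⟩
  2 ^ suc w * ((1 + 2 * t) * O)      ∎)
  where
  open ≡-Reasoning
  y²≡1+4t' : y * y ≡ 1 + 4 * (2 * t + 4 * t * t)
  y²≡1+4t' = trans (cong₂ _*_ y≡1+4t y≡1+4t) (square-1mod4 t)
  halved : ∃ λ O → Odd O × geom (y * y) (2 ^ w * m) ≡ 2 ^ w * O
  halved = geom-2-adic w {y * y} {2 * t + 4 * t * t} {m} y²≡1+4t' odd-m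
  O : ℕ
  O = proj₁ halved
  odd-O : Odd O
  odd-O = proj₁ (proj₂ halved)
  eq : geom (y * y) (2 ^ w * m) ≡ 2 ^ w * O
  eq = proj₂ (proj₂ halved)
  regroup : ∀ t a O → (2 + 4 * t) * (a * O) ≡ 2 * a * ((1 + 2 * t) * O)
  regroup = solve-∀

geom-even-length : ∀ w {y m} → Odd y → Odd m →
                   ∃ λ O → Odd O × geom y (2 ^ suc w * m) ≡ (1 + y) * (2 ^ w * O)
geom-even-length w {y} {m} odd-y odd-m = O , odd-O ,
  trans (cong (geom y) (*-assoc 2 (2 ^ w) m)) (trans (geom-double y (2 ^ w * m)) (cong ((1 + y) *_) eq))
  where
  y²≡1mod4 : ∃ λ t → y * y ≡ 1 + 4 * t
  y²≡1mod4 = odd-square odd-y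
  halved : ∃ λ O → Odd O × geom (y * y) (2 ^ w * m) ≡ 2 ^ w * O
  halved = geom-2-adic w {y * y} {proj₁ y²≡1mod4} {m} (proj₂ y²≡1mod4) odd-m
  O : ℕ
  O = proj₁ halved
  odd-O : Odd O
  odd-O = proj₁ (proj₂ halved)
  eq : geom (y * y) (2 ^ w * m) ≡ 2 ^ w * O
  eq = proj₂ (proj₂ halved)

-- For odd p and odd k: 1 + p^k = (1 + p) · (odd), the alternating sum
-- 1 - p + p² - … + p^(k-1) written as 1 + (p - 1) · p · geom (p²) ((k - 1)/2).
one+odd-power : ∀ {p k} → Odd p → Odd k → ∃ λ Q → Odd Q × 1 + p ^ k ≡ (1 + p) * Q
one+odd-power {p} (s , refl) (m , refl) = 1 + 2 * (s * p * g) , (s * p * g , refl) , (begin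
  1 + p ^ (1 + 2 * m)       ≡⟨ cong (λ e → 1 + p * e) (sym (^-*-assoc p 2 m)) ⟩
  1 + p * (p ^ 2) ^ m       ≡⟨ cong (λ b → 1 + p * b ^ m) (cong (p *_) (*-identityʳ p)) ⟩
  1 + p * (p * p) ^ m       ≡⟨ cong (λ e → 1 + p * e) (sym (geom-closed c m (p²≡1+c s))) ⟩
  1 + p * (c * g + 1)       ≡⟨ regroup s g ⟩
  (1 + p) * (1 + 2 * (s * p * g)) ∎)
  where
  open ≡-Reasoning
  g : ℕ
  g = geom (p * p) m
  c : ℕ
  c = 4 * (s + s * s)
  p²≡1+c : ∀ s → (1 + 2 * s) * (1 + 2 * s) ≡ suc (4 * (s + s * s))
  p²≡1+c = solve-∀
  regroup : ∀ s g → 1 + (1 + 2 * s) * (4 * (s + s * s) * g + 1)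
                  ≡ (1 + (1 + 2 * s)) * (1 + 2 * (s * (1 + 2 * s) * g))
  regroup = solve-∀

prime⇒1< : ∀ {q} → Prime q → 1 < q
prime⇒1< {q} pq = nonTrivial⇒n>1 q {{prime⇒nonTrivial pq}}

^-dvd-^ : ∀ c {i A} → i ≤ A → c ^ i ∣ c ^ A
^-dvd-^ c {i} {A} i≤A = divides (c ^ (A ∸ i))
  (trans (cong (c ^_) (sym (m+[n∸m]≡n i≤A))) (trans (^-distribˡ-+-* c i (A ∸ i)) (*-comm (c ^ i) _)))

^-injective : ∀ {p} → 1 < p → ∀ {y z} → p ^ y ≡ p ^ z → y ≡ z
^-injective {p} 1<p {y} {z} eq with <-cmp y z
... | tri< y<z _ _ = ⊥-elim (<-irrefl eq (^-monoʳ-< p 1<p y<z))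
... | tri≈ _ y≡z _ = y≡z
... | tri> _ _ y>z = ⊥-elim (<-irrefl (sym eq) (^-monoʳ-< p 1<p y>z))

prime∤^ : ∀ {q p} → Prime q → ¬ q ∣ p → ∀ n → ¬ q ∣ p ^ n
prime∤^ pq q∤p zero q∣1 = <-irrefl (sym (∣1⇒≡1 q∣1)) (prime⇒1< pq)
prime∤^ {p = p} pq q∤p (suc n) q∣pⁿ⁺¹ with euclidsLemma p (p ^ n) pq q∣pⁿ⁺¹
... | inj₁ q∣p = q∤p q∣p
... | inj₂ q∣pⁿ = prime∤^ pq q∤p n q∣pⁿ

prime∤⇒coprime : ∀ {q d} → Prime q → ¬ q ∣ d → Coprime d q
prime∤⇒coprime pq q∤d (i∣d , i∣q) with prime⇒irreducible pq i∣q
... | inj₁ i≡1 = i≡1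
... | inj₂ refl = ⊥-elim (q∤d i∣d)

prime-power-cancel : ∀ {q O} → Prime q → ¬ q ∣ O → ∀ A X → q ^ A ∣ X * O → q ^ A ∣ X
prime-power-cancel pq q∤O zero X _ = 1∣ X
prime-power-cancel {q} {O} pq q∤O (suc A) X qᴬ⁺¹∣XO
  with euclidsLemma X O pq (m*n∣⇒m∣ q (q ^ A) qᴬ⁺¹∣XO)
... | inj₂ q∣O = ⊥-elim (q∤O q∣O)
... | inj₁ (divides X' refl) = subst (q ^ suc A ∣_) (*-comm q X') (*-monoʳ-∣ q qᴬ∣X')
  where
  instance _ = prime⇒nonZero pq
  qᴬ∣X' : q ^ A ∣ X'
  qᴬ∣X' = prime-power-cancel pq q∤O A X' (*-cancelˡ-∣ q
    (subst (q * q ^ A ∣_) (trans (cong (_* O) (*-comm X' q)) (*-assoc q X' O)) qᴬ⁺¹∣XO))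

prime-power-split : ∀ {q} → Prime q → ∀ A m d → d ∣ q ^ A * m →
                    ∃₂ λ i e → i ≤ A × d ≡ q ^ i * e × e ∣ m
prime-power-split pq zero m d d∣m = 0 , d , z≤n , sym (*-identityˡ d) , subst (d ∣_) (*-identityˡ m) d∣m
prime-power-split {q} pq (suc A) m d d∣ with q ∣? d
... | yes (divides d' refl) with prime-power-split pq A m d' (*-cancelˡ-∣ q qd'∣)
  where
  instance _ = prime⇒nonZero pq
  qd'∣ : q * d' ∣ q * (q ^ A * m)
  qd'∣ = subst₂ _∣_ (*-comm d' q) (*-assoc q (q ^ A) m) d∣
...   | i , e , i≤A , refl , e∣m =
  suc i , e , s≤s i≤A , trans (*-comm _ q) (sym (*-assoc q (q ^ i) e)) , e∣m
prime-power-split {q} pq (suc A) m d d∣ | no q∤d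
  with prime-power-split pq A m d (coprime-divisor (prime∤⇒coprime pq q∤d) (subst (d ∣_) (*-assoc q (q ^ A) m) d∣))
... | i , e , i≤A , d≡qⁱe , e∣m = i , e , m≤n⇒m≤1+n i≤A , d≡qⁱe , e∣m

cross-divides : ∀ {q p X Y} A B → Prime q → Prime p → ¬ q ∣ X → ¬ p ∣ Y →
                q ^ A * p ^ B ∣ X * Y → q ^ A ∣ Y × p ^ B ∣ X
cross-divides {q} {p} {X} {Y} A B pq pp q∤X p∤Y qᴬpᴮ∣XY =
  prime-power-cancel pq q∤X A Y (subst (q ^ A ∣_) (*-comm X Y) (∣-trans (m∣m*n (p ^ B)) qᴬpᴮ∣XY)) ,
  prime-power-cancel pp p∤Y B X (∣-trans (n∣m*n (q ^ A)) qᴬpᴮ∣XY)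

∈divisors⇒∣ : ∀ n {x} → x ∈ divisors n → x ∣ n
∈divisors⇒∣ n x∈ = proj₂ (∈-filter⁻ (_∣? n) {xs = map suc (upTo n)} x∈)

∣⇒∈divisors : ∀ n .{{_ : NonZero n}} {x} → x ∣ n → x ∈ divisors n
∣⇒∈divisors n {zero} 0∣n = ⊥-elim (≢-nonZero⁻¹ n (0∣⇒≡0 0∣n))
∣⇒∈divisors n {suc x} x∣n = ∈-filter⁺ (_∣? n) (∈-map⁺ suc (∈-upTo⁺ (∣⇒≤ x∣n))) x∣n

divisors-unique : ∀ n → Unique (divisors n)
divisors-unique n = Unique.filter⁺ (_∣? n) (Unique.map⁺ suc-injective (Unique.upTo⁺ n))

^-distribʳ-* : ∀ a b k → (a * b) ^ k ≡ a ^ k * b ^ k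
^-distribʳ-* a b zero = refl
^-distribʳ-* a b (suc k) = trans (cong (a * b *_) (^-distribʳ-* a b k)) (interchange a b (a ^ k) (b ^ k))
  where
  interchange : ∀ a b x y → a * b * (x * y) ≡ a * x * (b * y)
  interchange = solve-∀

^-swap : ∀ c i k → (c ^ i) ^ k ≡ (c ^ k) ^ i
^-swap c i k = trans (^-*-assoc c i k) (trans (cong (c ^_) (*-comm i k)) (sym (^-*-assoc c k i)))

sum-cartesian : ∀ {A B C : Set} (F : A → B → C) (g : C → ℕ) (f : A → ℕ) (h : B → ℕ) →
                (∀ i j → g (F i j) ≡ f i * h j) → ∀ xs ys →
                sum (map g (cartesianProductWith F xs ys)) ≡ sum (map f xs) * sum (map h ys)
sum-cartesian F g f h factors [] ys = refl
sum-cartesian F g f h factors (x ∷ xs) ys = begin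
  sum (map g (map (F x) ys ++ cartesianProductWith F xs ys))
    ≡⟨ cong sum (map-++ g (map (F x) ys) (cartesianProductWith F xs ys)) ⟩
  sum (map g (map (F x) ys) ++ map g (cartesianProductWith F xs ys))
    ≡⟨ sum-++ (map g (map (F x) ys)) _ ⟩
  sum (map g (map (F x) ys)) + sum (map g (cartesianProductWith F xs ys))
    ≡⟨ cong₂ _+_ (row ys) (sum-cartesian F g f h factors xs ys) ⟩
  f x * sum (map h ys) + sum (map f xs) * sum (map h ys)
    ≡⟨ sym (*-distribʳ-+ (sum (map h ys)) (f x) _) ⟩
  sum (map f (x ∷ xs)) * sum (map h ys) ∎
  where
  open ≡-Reasoning
  row : ∀ ys → sum (map g (map (F x) ys)) ≡ f x * sum (map h ys)
  row [] = sym (*-zeroʳ (f x))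
  row (y ∷ ys) = trans (cong₂ _+_ (factors x y) (row ys)) (sym (*-distribˡ-+ (f x) _ _))

-- The divisors of q^A · p^B for distinct primes q, p are the q^i · p^j with
-- i ≤ A, j ≤ B, each listed once; hence σ_k(q^A · p^B) = σ_k(q^A) · σ_k(p^B).
module TwoPrimePowers {q p : ℕ} (q-prime : Prime q) (p-prime : Prime p) (q∤p : ¬ q ∣ p) where

  instance
    q≢0 : NonZero q
    q≢0 = prime⇒nonZero q-prime
    p≢0 : NonZero p
    p≢0 = prime⇒nonZero p-prime

  monomial : ℕ → ℕ → ℕ
  monomial i j = q ^ i * p ^ j

  monomial-injective : ∀ {w x y z} → monomial w y ≡ monomial x z → w ≡ x × y ≡ z
  monomial-injective {zero} {zero} {y} {z} eq =
    refl , ^-injective (prime⇒1< p-prime) (subst₂ _≡_ (*-identityˡ _) (*-identityˡ _) eq)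
  monomial-injective {suc w} {suc x} {y} {z} eq with monomial-injective {w} {x} {y} {z}
    (*-cancelˡ-≡ _ _ q (trans (sym (*-assoc q (q ^ w) (p ^ y))) (trans eq (*-assoc q (q ^ x) (p ^ z)))))
  ... | w≡x , y≡z = cong suc w≡x , y≡z
  monomial-injective {zero} {suc x} {y} {z} eq = ⊥-elim (prime∤^ q-prime q∤p y (divides (q ^ x * p ^ z)
    (trans (sym (*-identityˡ _)) (trans eq (trans (*-assoc q (q ^ x) (p ^ z)) (*-comm q (q ^ x * p ^ z)))))))
  monomial-injective {suc w} {zero} {y} {z} eq = ⊥-elim (prime∤^ q-prime q∤p z (divides (q ^ w * p ^ y)
    (trans (sym (*-identityˡ _)) (trans (sym eq) (trans (*-assoc q (q ^ w) (p ^ y)) (*-comm q (q ^ w * p ^ y)))))))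

  monomials : ℕ → ℕ → List ℕ
  monomials A B = cartesianProductWith monomial (upTo (suc A)) (upTo (suc B))

  monomials-unique : ∀ A B → Unique (monomials A B)
  monomials-unique A B = Unique.cartesianProductWith⁺ monomial monomial-injective
    (Unique.upTo⁺ (suc A)) (Unique.upTo⁺ (suc B))

  ∈monomials⇒∣ : ∀ A B {x} → x ∈ monomials A B → x ∣ q ^ A * p ^ B
  ∈monomials⇒∣ A B x∈ with ∈-cartesianProductWith⁻ monomial (upTo (suc A)) (upTo (suc B)) x∈
  ... | i , j , i∈ , j∈ , refl =
    *-pres-∣ (^-dvd-^ q (≤-pred (∈-upTo⁻ i∈))) (^-dvd-^ p (≤-pred (∈-upTo⁻ j∈)))

  ∣⇒∈monomials : ∀ A B {x} → x ∣ q ^ A * p ^ B → x ∈ monomials A B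
  ∣⇒∈monomials A B {x} x∣ with prime-power-split q-prime A (p ^ B) x x∣
  ... | i , e , i≤A , refl , e∣pᴮ
    with prime-power-split p-prime B 1 e (subst (e ∣_) (sym (*-identityʳ _)) e∣pᴮ)
  ... | j , e' , j≤B , refl , e'∣1 rewrite ∣1⇒≡1 e'∣1 | *-identityʳ (p ^ j) =
    ∈-cartesianProductWith⁺ monomial (∈-upTo⁺ (s≤s i≤A)) (∈-upTo⁺ (s≤s j≤B))

  σ-monomial : ∀ k A B → σ k (q ^ A * p ^ B) ≡ geom (q ^ k) (suc A) * geom (p ^ k) (suc B)
  σ-monomial k A B = begin
    σ k n
      ≡⟨ sum-↭ (Perm.map⁺ (_^ k) divisors↭monomials) ⟩
    sum (map (_^ k) (monomials A B))
      ≡⟨ sum-cartesian monomial (_^ k) ((q ^ k) ^_) ((p ^ k) ^_) power-factors (upTo (suc A)) (upTo (suc B)) ⟩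
    sum (map ((q ^ k) ^_) (upTo (suc A))) * sum (map ((p ^ k) ^_) (upTo (suc B)))
      ≡⟨ cong₂ _*_ (sum-powers≡geom (q ^ k) (suc A)) (sum-powers≡geom (p ^ k) (suc B)) ⟩
    geom (q ^ k) (suc A) * geom (p ^ k) (suc B) ∎
    where
    open ≡-Reasoning
    n : ℕ
    n = q ^ A * p ^ B
    n≢0 : NonZero n
    n≢0 = m*n≢0 (q ^ A) (p ^ B) {{m^n≢0 q A}} {{m^n≢0 p B}}
    power-factors : ∀ i j → monomial i j ^ k ≡ (q ^ k) ^ i * (p ^ k) ^ j
    power-factors i j = trans (^-distribʳ-* (q ^ i) (p ^ j) k) (cong₂ _*_ (^-swap q i k) (^-swap p j k))
    divisors↭monomials : divisors n ↭ monomials A B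
    divisors↭monomials = ∼bag⇒↭ (unique∧set⇒bag (divisors-unique n) (monomials-unique A B)
      (mk⇔ (λ x∈ → ∣⇒∈monomials A B (∈divisors⇒∣ n x∈)) (λ x∈ → ∣⇒∈divisors n {{n≢0}} (∈monomials⇒∣ A B x∈))))

σ-odd-prime-power-2-part : ∀ w {p k m} → Odd p → Odd k → Odd m →
                           ∃ λ O → Odd O × geom (p ^ k) (2 ^ suc w * m) ≡ 2 ^ w * (1 + p) * O
σ-odd-prime-power-2-part w {p} {k} {m} odd-p odd-k odd-m = Q * O , odd-* odd-Q odd-O , (begin
  geom (p ^ k) (2 ^ suc w * m) ≡⟨ geom≡ ⟩
  (1 + p ^ k) * (2 ^ w * O)    ≡⟨ cong (_* (2 ^ w * O)) 1+pᵏ≡ ⟩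
  (1 + p) * Q * (2 ^ w * O)    ≡⟨ regroup (1 + p) Q (2 ^ w) O ⟩
  2 ^ w * (1 + p) * (Q * O)    ∎)
  where
  open ≡-Reasoning
  halving : ∃ λ O → Odd O × geom (p ^ k) (2 ^ suc w * m) ≡ (1 + p ^ k) * (2 ^ w * O)
  halving = geom-even-length w (odd-^ odd-p k) odd-m
  O : ℕ
  O = proj₁ halving
  odd-O : Odd O
  odd-O = proj₁ (proj₂ halving)
  geom≡ : geom (p ^ k) (2 ^ suc w * m) ≡ (1 + p ^ k) * (2 ^ w * O)
  geom≡ = proj₂ (proj₂ halving)
  factor : ∃ λ Q → Odd Q × 1 + p ^ k ≡ (1 + p) * Q
  factor = one+odd-power odd-p odd-k
  Q : ℕ
  Q = proj₁ factor
  odd-Q : Odd Q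
  odd-Q = proj₁ (proj₂ factor)
  1+pᵏ≡ : 1 + p ^ k ≡ (1 + p) * Q
  1+pᵏ≡ = proj₂ (proj₂ factor)
  regroup : ∀ a Q b O → a * Q * (b * O) ≡ b * a * (Q * O)
  regroup = solve-∀

two-power-bound : ∀ A w {p k m} → 1 < p → Odd p → Odd k → Odd m →
                  2 ^ A ∣ geom (p ^ k) (2 ^ suc w * m) → 2 ^ suc A ≤ 2 ^ w * (p * p)
two-power-bound A w {p} {k} {m} 1<p odd-p odd-k odd-m 2ᴬ∣ = begin
  2 * 2 ^ A             ≤⟨ *-monoʳ-≤ 2 (∣⇒≤ {{2ʷ[1+p]≢0}} 2ᴬ∣2ʷ[1+p]) ⟩
  2 * (2 ^ w * (1 + p)) ≡⟨ regroup (2 ^ w) (1 + p) ⟩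
  2 ^ w * (2 * (1 + p)) ≤⟨ *-monoʳ-≤ (2 ^ w) (double-succ≤square 1<p odd-p) ⟩
  2 ^ w * (p * p)       ∎
  where
  open ≤-Reasoning
  split : ∃ λ O → Odd O × geom (p ^ k) (2 ^ suc w * m) ≡ 2 ^ w * (1 + p) * O
  split = σ-odd-prime-power-2-part w odd-p odd-k odd-m
  2ᴬ∣2ʷ[1+p] : 2 ^ A ∣ 2 ^ w * (1 + p)
  2ᴬ∣2ʷ[1+p] = prime-power-cancel prime[2] (odd⇒¬2∣ (proj₁ (proj₂ split))) A _
    (subst (2 ^ A ∣_) (proj₂ (proj₂ split)) 2ᴬ∣)
  2ʷ[1+p]≢0 : NonZero (2 ^ w * (1 + p))
  2ʷ[1+p]≢0 = m*n≢0 (2 ^ w) (1 + p) {{m^n≢0 2 w}}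
  regroup : ∀ a b → 2 * (a * b) ≡ a * (2 * b)
  regroup = solve-∀

-- p^B ∣ σ_k(2^A) forces p^B · (2^k - 1) < (2^(A+1))^k, since (2^k - 1) · σ_k(2^A) + 1 = 2^(k(A+1)).
p-power-bound : ∀ k A {p B} → p ^ B ∣ geom (2 ^ k) (suc A) → p ^ B * (2 ^ k ∸ 1) < (2 ^ suc A) ^ k
p-power-bound k A {p} {B} pᴮ∣ = begin-strict
  p ^ B * M        ≤⟨ *-monoˡ-≤ M (∣⇒≤ pᴮ∣) ⟩
  S * M            ≡⟨ *-comm S M ⟩
  M * S            <⟨ m<m+n (M * S) (s≤s z≤n) ⟩
  M * S + 1        ≡⟨ geom-closed M (suc A) 2ᵏ≡1+M ⟩
  (2 ^ k) ^ suc A  ≡⟨ ^-swap 2 k (suc A) ⟩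
  (2 ^ suc A) ^ k  ∎
  where
  open ≤-Reasoning
  M : ℕ
  M = 2 ^ k ∸ 1
  S : ℕ
  S = geom (2 ^ k) (suc A)
  2ᵏ≡1+M : 2 ^ k ≡ suc M
  2ᵏ≡1+M = sym (trans (+-comm 1 M) (m∸n+n≡m (m^n>0 2 k)))

power-rearrange : ∀ p w k → p * (2 ^ w * (p * p)) ^ k ≡ p ^ (2 * k + 1) * 2 ^ (k * w)
power-rearrange p w k = begin
  p * (2 ^ w * (p * p)) ^ k       ≡⟨ cong (p *_) (^-distribʳ-* (2 ^ w) (p * p) k) ⟩
  p * ((2 ^ w) ^ k * (p * p) ^ k) ≡⟨ cong₂ (λ a b → p * (a * b)) 2ʷᵏ p²ᵏ ⟩
  p * (2 ^ (k * w) * p ^ (2 * k)) ≡⟨ regroup p (2 ^ (k * w)) (p ^ (2 * k)) ⟩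
  p * p ^ (2 * k) * 2 ^ (k * w)   ≡⟨ cong (λ e → p ^ e * 2 ^ (k * w)) (+-comm 1 (2 * k)) ⟩
  p ^ (2 * k + 1) * 2 ^ (k * w)   ∎
  where
  open ≡-Reasoning
  2ʷᵏ : (2 ^ w) ^ k ≡ 2 ^ (k * w)
  2ʷᵏ = trans (^-*-assoc 2 w k) (cong (2 ^_) (*-comm w k))
  p²ᵏ : (p * p) ^ k ≡ p ^ (2 * k)
  p²ᵏ = trans (cong (λ b → (p * b) ^ k) (sym (*-identityʳ p))) (^-*-assoc p 2 k)
  regroup : ∀ p a b → p * (a * b) ≡ p * b * a
  regroup = solve-∀

cleared-inequality : ∀ k → 2 < k → Prime k → ∀ A B p → Prime p → Odd p →
                     2 ^ A * p ^ B ∣ σ k (2 ^ A * p ^ B) →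
                     ∀ w m → Odd m → suc B ≡ 2 ^ suc w * m →
                     p ^ (2 ^ suc w) * (2 ^ k ∸ 1) < p ^ (2 * k + 1) * 2 ^ (k * w)
cleared-inequality zero () _ _ _ _ _ _ _ _ _ _ _
cleared-inequality k@(suc k') 2<k k-prime A B p p-prime odd-p n∣σn w m odd-m 1+B≡ = begin-strict
  p ^ (2 ^ suc w) * M        ≤⟨ *-monoˡ-≤ M (^-monoʳ-≤ p 2ᵛ≤1+B) ⟩
  p * p ^ B * M              ≡⟨ *-assoc p (p ^ B) M ⟩
  p * (p ^ B * M)            <⟨ *-monoʳ-< p (p-power-bound k A {p} {B} pᴮ∣S₂) ⟩
  p * (2 ^ suc A) ^ k        ≤⟨ *-monoʳ-≤ p (^-monoˡ-≤ k (two-power-bound A w 1<p odd-p odd-k odd-m 2ᴬ∣Sₚ)) ⟩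
  p * (2 ^ w * (p * p)) ^ k  ≡⟨ power-rearrange p w k ⟩
  p ^ (2 * k + 1) * 2 ^ (k * w) ∎
  where
  open ≤-Reasoning
  instance
    p≢0 : NonZero p
    p≢0 = prime⇒nonZero p-prime
  M : ℕ
  M = 2 ^ k ∸ 1
  1<p : 1 < p
  1<p = prime⇒1< p-prime
  odd-k : Odd k
  odd-k = odd-prime k-prime 2<k
  2ᵛ≤1+B : 2 ^ suc w ≤ suc B
  2ᵛ≤1+B = subst (2 ^ suc w ≤_) (sym 1+B≡) (m≤m*n (2 ^ suc w) m {{odd⇒nonZero odd-m}})
  S₂ Sₚ : ℕ
  S₂ = geom (2 ^ k) (suc A)
  Sₚ = geom (p ^ k) (suc B)
  2∤S₂ : ¬ 2 ∣ S₂
  2∤S₂ = ∤1+multiple (geom (2 ^ k) A) (s≤s (s≤s z≤n)) (m∣m*n (2 ^ k'))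
  p∤Sₚ : ¬ p ∣ Sₚ
  p∤Sₚ = ∤1+multiple (geom (p ^ k) B) 1<p (m∣m*n (p ^ k'))
  halves : 2 ^ A ∣ Sₚ × p ^ B ∣ S₂
  halves = cross-divides A B prime[2] p-prime 2∤S₂ p∤Sₚ
    (subst (2 ^ A * p ^ B ∣_) (TwoPrimePowers.σ-monomial prime[2] p-prime (odd⇒¬2∣ odd-p) k A B) n∣σn)
  2ᴬ∣Sₚ : 2 ^ A ∣ geom (p ^ k) (2 ^ suc w * m)
  2ᴬ∣Sₚ = subst (λ n → 2 ^ A ∣ geom (p ^ k) n) 1+B≡ (proj₁ halves)
  pᴮ∣S₂ : p ^ B ∣ S₂
  pᴮ∣S₂ = proj₂ halves

/-<-/ : ∀ a b c d .{{_ : NonZero c}} .{{_ : NonZero d}} → a * d < b * c → (+ a / c) <ℚ (+ b / d)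
/-<-/ a b c@(suc c') d@(suc d') ad<bc = ℚ.toℚᵘ-cancel-<
  (ℚᵘ.<-respˡ-≃ (ℚᵘ.≃-sym (ℚ.toℚᵘ-fromℚᵘ (mkℚᵘ (+ a) c')))
    (ℚᵘ.<-respʳ-≃ (ℚᵘ.≃-sym (ℚ.toℚᵘ-fromℚᵘ (mkℚᵘ (+ b) d')))
      (ℚᵘ.*<* (subst₂ ℤ._<_ (ℤ.pos-* a d) (ℤ.pos-* b c) (ℤ.+<+ ad<bc)))))

zpow-<-/ : ∀ {p M R} .{{_ : NonZero p}} .{{_ : NonZero M}} a b →
           p ^ a * M < p ^ b * R → zpow p (a ⊖ b) <ℚ (+ R / M)
zpow-<-/ {p} {M} {R} a zero pᵃM<R =
  /-<-/ (p ^ a) R 1 M (subst (p ^ a * M <_) (*-comm 1 R) pᵃM<R)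
zpow-<-/ {p} {M} {R} zero (suc b) M<pᵇR =
  /-<-/ 1 R (p ^ suc b) M {{m^n≢0 p (suc b)}} (subst (1 * M <_) (*-comm (p ^ suc b) R) M<pᵇR)
zpow-<-/ {p} {M} {R} (suc a) (suc b) pᵃ⁺¹M<pᵇ⁺¹R =
  subst (λ e → zpow p e <ℚ (+ R / M)) (sym (ℤ.[1+m]⊖[1+n]≡m⊖n a b))
    (zpow-<-/ a b (*-cancelˡ-< p _ _ (subst₂ _<_ (*-assoc p (p ^ a) M) (*-assoc p (p ^ b) R) pᵃ⁺¹M<pᵇ⁺¹R)))

lemma4p3 : (k : ℕ) → 2 < k → Prime k → (hM : Prime (2 ^ k ∸ 1)) →
           (α β p : ℕ) → 1 < α → 1 < β →
           (hp : Prime p) → p % 2 ≡ 1 →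
           p < 3 * 2 ^ (α ∸ 1) ∸ 1 → p % 4 ≡ 3 →
           (2 ^ (α ∸ 1) * p ^ (β ∸ 1)) ∣ σ k (2 ^ (α ∸ 1) * p ^ (β ∸ 1)) →
           (v β₁ : ℕ) → β ≡ 2 ^ v * β₁ → 1 ≤ v → β₁ % 2 ≡ 1 →
           _<ℚ_ (zpow p {{prime⇒nonZero hp}} (+ (2 ^ v) - + (2 * k + 1)))
                (_/_ (+ (2 ^ (k * (v ∸ 1)))) (2 ^ k ∸ 1) {{prime⇒nonZero hM}})
lemma4p3 k 2<k k-prime hM α β p _ 1<β hp p%2≡1 _ _ n∣σn zero β₁ β≡ () β₁%2≡1
lemma4p3 k 2<k k-prime hM α β p _ 1<β hp p%2≡1 _ _ n∣σn (suc w) β₁ β≡ _ β₁%2≡1 =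
  subst (λ e → zpow p e <ℚ (+ (2 ^ (k * w)) / (2 ^ k ∸ 1))) (sym (ℤ.[+m]-[+n]≡m⊖n (2 ^ suc w) (2 * k + 1)))
    (zpow-<-/ (2 ^ suc w) (2 * k + 1)
      (cleared-inequality k 2<k k-prime (α ∸ 1) (β ∸ 1) p hp (%2≡1⇒odd p p%2≡1) n∣σn
        w β₁ (%2≡1⇒odd β₁ β₁%2≡1) 1+[β-1]≡β))
  where
  instance
    p≢0 : NonZero p
    p≢0 = prime⇒nonZero hp
    M≢0 : NonZero (2 ^ k ∸ 1)
    M≢0 = prime⇒nonZero hM
  1+[β-1]≡β : suc (β ∸ 1) ≡ 2 ^ suc w * β₁
  1+[β-1]≡β = trans (trans (+-comm 1 (β ∸ 1)) (m∸n+n≡m (<⇒≤ 1<β))) β≡
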